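{- For all integers $n$ and $r$ with $3 \leq r \leq n-2$, \[ A(n,r-1)\bigl(A(n,r-1)-1\bigr) > 2A(n,3r-2). \]
   Context: $A(n,q)$ is the Eulerian number (number of permutations of $\{1,\dots,n\}$ with exactly $q$ ascents), with the convention $A(n,q)=0$ if $q \geq n$. -}

module Defs where

open import Data.Nat using (ℕ; zero; suc; _<ᵇ_; _+_)
open import Data.Bool using (Bool; true; false; if_then_else_)
open import Data.List using (List; []; _∷_; concatMap; map; length; filterᵇ; upTo)
open import Data.Nat using (_≡ᵇ_)

insertions : ℕ → List ℕ → List (List ℕ)
insertions x [] = (x ∷ []) ∷ []
insertions x (y ∷ ys) = (x ∷ y ∷ ys) ∷ map (y ∷_) (insertions x ys)

-- All permutations of a list (as a list of lists; each permutation appears once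
-- when the input has distinct entries).
permutations : List ℕ → List (List ℕ)
permutations [] = [] ∷ []
permutations (x ∷ xs) = concatMap (insertions x) (permutations xs)

oneTo : ℕ → List ℕ
oneTo n = map suc (upTo n)

ascents : List ℕ → ℕ
ascents [] = 0
ascents (x ∷ []) = 0
ascents (x ∷ y ∷ ys) = (if x <ᵇ y then 1 else 0) + ascents (y ∷ ys)

-- Eulerian number A(n,q): number of permutations of {1,...,n} with exactly q ascents.
-- (Automatically 0 when q ≥ n, for n ≥ 1.)
eulerian : ℕ → ℕ → ℕ
eulerian n q = length (filterᵇ (λ w → ascents w ≡ᵇ q) (permutations (oneTo n)))

{-# OPTIONS --safe #-}
module Submission where

-- Write k = r − 1 ≥ 2. Inserting the smallest letter into the permutations of the others gives
-- the recurrence A(n+1, c+1) = (c+2) A(n, c+1) + (n−c) A(n, c), and everything else follows from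
-- it: the symmetry A(n, q) = A(n, n−1−q), the lower bound A(n, k) ≥ (k+1)^(n−k−1), and the upper
-- bound A(n, q) ≤ (q+1)^n read off Worpitzky's identity (m+1)^n = Σ_i A(n, i) C(m+n−i, n).
-- Since A(n, k) ≥ 2, it suffices to show 4 A(n, 3k+1) < A(n, k)². For n ≤ 3k+1 the left side
-- vanishes; for n ≤ 4k+2 symmetry gives A(n, 3k+1) ≤ (k+1)^n, which the lower bound beats.
-- For n ≥ 4k+3 we show 4 (3k+2)^n < A(n, k)²: at n = 4k+3 by an estimate when k ≥ 12 and by
-- evaluating the Eulerian triangle when k < 12, and from there on for all larger n, because
-- A(n, k) grows at least by the factor k+1 with n and (k+1)² ≥ 3k+2.

open import Defs
open import Data.Bool using (true; false; if_then_else_; T)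
open import Data.Bool.Properties using (T-≡)
open import Data.List using (List; []; _∷_; _++_; map; length; filterᵇ; concatMap; upTo; applyUpTo)
open import Data.List.Properties
  using (map-∘; length-map; length-applyUpTo; map-applyUpTo; concatMap-map; concatMap-cong; map-concatMap)
open import Data.List.Relation.Unary.All as All using (All; []; _∷_)
open import Data.List.Relation.Unary.All.Properties using (concat⁺; map⁺)
open import Data.List.Relation.Binary.Permutation.Propositional
  using (_↭_; ↭-refl; ↭-prep; ↭-swap; ↭-trans; ↭-sym)
open import Data.List.Relation.Binary.Permutation.Propositional.Properties using (All-resp-↭; ↭-length)
open import Data.Nat hiding (_>_)
open import Data.Nat.Properties
open import Data.Nat.Tactic.RingSolver using (solve-∀)
open import Data.Product using (_,_)
open import Function using (_∘_; Equivalence)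
open import Relation.Binary.PropositionalEquality
open import Relation.Nullary using (yes; no; contradiction)
import Data.Integer.Properties as ℤ

<⇒<ᵇ≡true : ∀ {m n} → m < n → (m <ᵇ n) ≡ true
<⇒<ᵇ≡true m<n = Equivalence.to T-≡ (<⇒<ᵇ m<n)

≤⇒<ᵇ≡false : ∀ {m n} → n ≤ m → (m <ᵇ n) ≡ false
≤⇒<ᵇ≡false {m} {n} n≤m with m <ᵇ n in eq
... | false = refl
... | true  = contradiction (<ᵇ⇒< m n (Equivalence.from T-≡ eq)) (≤⇒≯ n≤m)

ascents≤length : ∀ y ys → ascents (y ∷ ys) ≤ length ys
ascents≤length y []       = z≤n
ascents≤length y (z ∷ zs) with y <ᵇ z
... | true  = s≤s (ascents≤length z zs)
... | false = m≤n⇒m≤1+n (ascents≤length z zs)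

δ : ℕ → ℕ → ℕ
δ a c = if a ≡ᵇ c then 1 else 0

δ-* : ∀ a c (f : ℕ → ℕ) → δ a c * f a ≡ δ a c * f c
δ-* a c f with a ≡ᵇ c in eq
... | true  rewrite ≡ᵇ⇒≡ a c (Equivalence.from T-≡ eq) = refl
... | false = refl

count : ℕ → List (List ℕ) → ℕ
count c []       = 0
count c (w ∷ ws) = δ (ascents w) c + count c ws

length-filter≡count : ∀ c ws → length (filterᵇ (λ w → ascents w ≡ᵇ c) ws) ≡ count c ws
length-filter≡count c []       = refl
length-filter≡count c (w ∷ ws) with ascents w ≡ᵇ c
... | true  = cong suc (length-filter≡count c ws)
... | false = length-filter≡count c ws

count-++ : ∀ c ws vs → count c (ws ++ vs) ≡ count c ws + count c vs
count-++ c []       vs = refl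
count-++ c (w ∷ ws) vs =
  trans (cong (δ (ascents w) c +_) (count-++ c ws vs)) (sym (+-assoc (δ (ascents w) c) _ _))

count-concatMap : ∀ c c₁ c₂ α β (f : List ℕ → List (List ℕ)) ws →
  All (λ w → count c (f w) ≡ α * δ (ascents w) c₁ + β * δ (ascents w) c₂) ws →
  count c (concatMap f ws) ≡ α * count c₁ ws + β * count c₂ ws
count-concatMap c c₁ c₂ α β f []       []         = sym (cong₂ _+_ (*-zeroʳ α) (*-zeroʳ β))
count-concatMap c c₁ c₂ α β f (w ∷ ws) (fw ∷ fws) = begin
  count c (f w ++ concatMap f ws)
    ≡⟨ count-++ c (f w) _ ⟩
  count c (f w) + count c (concatMap f ws)
    ≡⟨ cong₂ _+_ fw (count-concatMap c c₁ c₂ α β f ws fws) ⟩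
  (α * x₁ + β * x₂) + (α * count c₁ ws + β * count c₂ ws)
    ≡⟨ rearrange α β x₁ x₂ _ _ ⟩
  α * (x₁ + count c₁ ws) + β * (x₂ + count c₂ ws)
    ∎
  where
  open ≡-Reasoning
  x₁ = δ (ascents w) c₁
  x₂ = δ (ascents w) c₂
  rearrange : ∀ a b x y u v → (a * x + b * y) + (a * u + b * v) ≡ a * (x + u) + b * (y + v)
  rearrange = solve-∀

-- Inserting a new minimum into a word of length m with a ascents: of the m + 1 slots,
-- the a + 1 slots inside an ascent or at the end keep a ascents, the other m − a add one.
insertionCount : ℕ → ℕ → ℕ → ℕ
insertionCount a m c = δ a c * suc a + δ (suc a) c * (m ∸ a)

insertionCount-empty : ∀ c → δ 0 c + 0 ≡ insertionCount 0 0 c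
insertionCount-empty c = sym (cong₂ _+_ (*-identityʳ (δ 0 c)) (*-zeroʳ (δ 1 c)))

insertionCount-suc-length : ∀ b m c → b ≤ m →
  δ (suc b) c + insertionCount b m c ≡ insertionCount b (suc m) c
insertionCount-suc-length b m c b≤m = begin
  δ (suc b) c + (δ b c * suc b + δ (suc b) c * (m ∸ b))
    ≡⟨ shuffle (δ (suc b) c) (δ b c * suc b) (m ∸ b) ⟩
  δ b c * suc b + δ (suc b) c * suc (m ∸ b)
    ≡⟨ cong (λ d → δ b c * suc b + δ (suc b) c * d) (+-∸-assoc 1 b≤m) ⟨
  δ b c * suc b + δ (suc b) c * (suc m ∸ b)
    ∎
  where
  open ≡-Reasoning
  shuffle : ∀ p q d → p + (q + p * d) ≡ q + p * suc d
  shuffle = solve-∀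

insertionCount-suc-suc : ∀ b m c → insertionCount (suc b) (suc m) (suc c) ≡ δ b c + insertionCount b m c
insertionCount-suc-suc b m c = shuffle (δ b c) b (δ (suc b) c * (m ∸ b))
  where
  shuffle : ∀ p b q → p * suc (suc b) + q ≡ p + (p * suc b + q)
  shuffle = solve-∀

insertionCount-zero-ascents : ∀ a m → insertionCount a m 0 ≡ 1 * δ a 0 + 0 * δ a 0
insertionCount-zero-ascents a m = begin
  δ a 0 * suc a + 0  ≡⟨ +-identityʳ _ ⟩
  δ a 0 * suc a      ≡⟨ δ-* a 0 suc ⟩
  δ a 0 * 1          ≡⟨ *-comm (δ a 0) 1 ⟩
  1 * δ a 0          ≡⟨ +-identityʳ _ ⟨
  1 * δ a 0 + 0      ∎
  where open ≡-Reasoning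

insertionCount-suc-ascents : ∀ a m c →
  insertionCount a m (suc c) ≡ suc (suc c) * δ a (suc c) + (m ∸ c) * δ a c
insertionCount-suc-ascents a m c = begin
  δ a (suc c) * suc a + δ a c * (m ∸ a)       ≡⟨ cong₂ _+_ (δ-* a (suc c) suc) (δ-* a c (m ∸_)) ⟩
  δ a (suc c) * suc (suc c) + δ a c * (m ∸ c) ≡⟨ cong₂ _+_ (*-comm (δ a (suc c)) _) (*-comm (δ a c) _) ⟩
  suc (suc c) * δ a (suc c) + (m ∸ c) * δ a c ∎
  where open ≡-Reasoning

module _ {y z : ℕ} where

  count-cons-descent : (y <ᵇ z) ≡ false → ∀ c ws →
    count c (map (y ∷_) (map (z ∷_) ws)) ≡ count c (map (z ∷_) ws)
  count-cons-descent y≮z c []       = refl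
  count-cons-descent y≮z c (u ∷ ws) rewrite y≮z =
    cong (δ (ascents (z ∷ u)) c +_) (count-cons-descent y≮z c ws)

  count-cons-ascent : (y <ᵇ z) ≡ true → ∀ c ws →
    count (suc c) (map (y ∷_) (map (z ∷_) ws)) ≡ count c (map (z ∷_) ws)
  count-cons-ascent y<z c []       = refl
  count-cons-ascent y<z c (u ∷ ws) rewrite y<z =
    cong (δ (ascents (z ∷ u)) c +_) (count-cons-ascent y<z c ws)

  count-zero-cons-ascent : (y <ᵇ z) ≡ true → ∀ ws → count 0 (map (y ∷_) (map (z ∷_) ws)) ≡ 0
  count-zero-cons-ascent y<z []       = refl
  count-zero-cons-ascent y<z (u ∷ ws) rewrite y<z = count-zero-cons-ascent y<z ws

count-map-cons-insertions : ∀ {x} y ys → All (x <_) (y ∷ ys) → ∀ c →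
  count c (map (y ∷_) (insertions x ys)) ≡ insertionCount (ascents (y ∷ ys)) (length ys) c
count-map-cons-insertions y [] (x<y ∷ []) c rewrite ≤⇒<ᵇ≡false (<⇒≤ x<y) = insertionCount-empty c
count-map-cons-insertions {x} y (z ∷ zs) (x<y ∷ x<z ∷ x<zs) c
  rewrite ≤⇒<ᵇ≡false (<⇒≤ x<y) | <⇒<ᵇ≡true x<z with y <ᵇ z in y?z | c
... | false | c = begin
  δ (suc b) c + count c (map (y ∷_) (map (z ∷_) I))
    ≡⟨ cong (δ (suc b) c +_) (count-cons-descent y?z c I) ⟩
  δ (suc b) c + count c (map (z ∷_) I)
    ≡⟨ cong (δ (suc b) c +_) (count-map-cons-insertions z zs (x<z ∷ x<zs) c) ⟩
  δ (suc b) c + insertionCount b (length zs) c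
    ≡⟨ insertionCount-suc-length b (length zs) c (ascents≤length z zs) ⟩
  insertionCount b (suc (length zs)) c
    ∎
  where
  open ≡-Reasoning
  b = ascents (z ∷ zs)
  I = insertions x zs
... | true | zero = cong (δ (suc (ascents (z ∷ zs))) 0 +_) (count-zero-cons-ascent y?z (insertions x zs))
... | true | suc c = begin
  δ b c + count (suc c) (map (y ∷_) (map (z ∷_) I))
    ≡⟨ cong (δ b c +_) (count-cons-ascent y?z c I) ⟩
  δ b c + count c (map (z ∷_) I)
    ≡⟨ cong (δ b c +_) (count-map-cons-insertions z zs (x<z ∷ x<zs) c) ⟩
  δ b c + insertionCount b (length zs) c
    ≡⟨ insertionCount-suc-suc b (length zs) c ⟨
  insertionCount (suc b) (suc (length zs)) (suc c)
    ∎
  where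
  open ≡-Reasoning
  b = ascents (z ∷ zs)
  I = insertions x zs

count-insertions : ∀ x w → All (x <_) w → ∀ c →
  count c (insertions x w) ≡ insertionCount (ascents w) (length w) c
count-insertions x []       []                  c = insertionCount-empty c
count-insertions x (y ∷ ys) x<y∷ys@(x<y ∷ _) c rewrite <⇒<ᵇ≡true x<y = begin
  δ (suc a) c + count c (map (y ∷_) (insertions x ys))
    ≡⟨ cong (δ (suc a) c +_) (count-map-cons-insertions y ys x<y∷ys c) ⟩
  δ (suc a) c + insertionCount a (length ys) c
    ≡⟨ insertionCount-suc-length a (length ys) c (ascents≤length y ys) ⟩
  insertionCount a (suc (length ys)) c
    ∎
  where
  open ≡-Reasoning
  a = ascents (y ∷ ys)

insertions-↭ : ∀ x w → All (_↭ x ∷ w) (insertions x w)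
insertions-↭ x []       = ↭-refl ∷ []
insertions-↭ x (y ∷ ys) =
  ↭-refl ∷ map⁺ (All.map (λ u↭x∷ys → ↭-trans (↭-prep y u↭x∷ys) (↭-swap y x ↭-refl)) (insertions-↭ x ys))

permutations-↭ : ∀ xs → All (_↭ xs) (permutations xs)
permutations-↭ []       = ↭-refl ∷ []
permutations-↭ (x ∷ xs) = concat⁺ (map⁺ (All.map insertions-↭xs (permutations-↭ xs)))
  where
  insertions-↭xs : ∀ {w} → w ↭ xs → All (_↭ x ∷ xs) (insertions x w)
  insertions-↭xs w↭xs = All.map (λ u↭x∷w → ↭-trans u↭x∷w (↭-prep x w↭xs)) (insertions-↭ x _)

module _ (x : ℕ) {ys : List ℕ} (x<ys : All (x <_) ys) where

  private
    P = permutations ys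

    count-insertions-permutation : ∀ {w} → w ↭ ys → ∀ c →
      count c (insertions x w) ≡ insertionCount (ascents w) (length ys) c
    count-insertions-permutation {w} w↭ys c = begin
      count c (insertions x w)                 ≡⟨ count-insertions x w (All-resp-↭ (↭-sym w↭ys) x<ys) c ⟩
      insertionCount (ascents w) (length w) c  ≡⟨ cong (λ m → insertionCount (ascents w) m c) (↭-length w↭ys) ⟩
      insertionCount (ascents w) (length ys) c ∎
      where open ≡-Reasoning

  count-permutations-cons-zero : count 0 (permutations (x ∷ ys)) ≡ count 0 P
  count-permutations-cons-zero = begin
    count 0 (concatMap (insertions x) P)
      ≡⟨ count-concatMap 0 0 0 1 0 (insertions x) P (All.map per-word (permutations-↭ ys)) ⟩
    1 * count 0 P + 0 * count 0 P
      ≡⟨ trans (+-identityʳ _) (*-identityˡ _) ⟩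
    count 0 P
      ∎
    where
    open ≡-Reasoning
    per-word : ∀ {w} → w ↭ ys → count 0 (insertions x w) ≡ 1 * δ (ascents w) 0 + 0 * δ (ascents w) 0
    per-word {w} w↭ys =
      trans (count-insertions-permutation w↭ys 0) (insertionCount-zero-ascents (ascents w) (length ys))

  count-permutations-cons-suc : ∀ c → count (suc c) (permutations (x ∷ ys)) ≡
    suc (suc c) * count (suc c) P + (length ys ∸ c) * count c P
  count-permutations-cons-suc c = count-concatMap (suc c) (suc c) c (suc (suc c)) (length ys ∸ c)
    (insertions x) P (All.map per-word (permutations-↭ ys))
    where
    per-word : ∀ {w} → w ↭ ys →
      count (suc c) (insertions x w) ≡ suc (suc c) * δ (ascents w) (suc c) + (length ys ∸ c) * δ (ascents w) c
    per-word {w} w↭ys =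
      trans (count-insertions-permutation w↭ys (suc c)) (insertionCount-suc-ascents (ascents w) (length ys) c)

ascents-map-suc : ∀ w → ascents (map suc w) ≡ ascents w
ascents-map-suc []           = refl
ascents-map-suc (x ∷ [])     = refl
ascents-map-suc (x ∷ y ∷ ys) = cong ((if x <ᵇ y then 1 else 0) +_) (ascents-map-suc (y ∷ ys))

insertions-map-suc : ∀ x ys → insertions (suc x) (map suc ys) ≡ map (map suc) (insertions x ys)
insertions-map-suc x []       = refl
insertions-map-suc x (y ∷ ys) = cong ((suc x ∷ suc y ∷ map suc ys) ∷_) (begin
  map (suc y ∷_) (insertions (suc x) (map suc ys)) ≡⟨ cong (map (suc y ∷_)) (insertions-map-suc x ys) ⟩
  map (suc y ∷_) (map (map suc) (insertions x ys)) ≡⟨ map-∘ (insertions x ys) ⟨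
  map (map suc ∘ (y ∷_)) (insertions x ys)         ≡⟨ map-∘ (insertions x ys) ⟩
  map (map suc) (map (y ∷_) (insertions x ys))     ∎)
  where open ≡-Reasoning

permutations-map-suc : ∀ xs → permutations (map suc xs) ≡ map (map suc) (permutations xs)
permutations-map-suc []       = refl
permutations-map-suc (x ∷ xs) = begin
  concatMap (insertions (suc x)) (permutations (map suc xs))
    ≡⟨ cong (concatMap (insertions (suc x))) (permutations-map-suc xs) ⟩
  concatMap (insertions (suc x)) (map (map suc) P)
    ≡⟨ concatMap-map (insertions (suc x)) (map suc) P ⟩
  concatMap (insertions (suc x) ∘ map suc) P
    ≡⟨ concatMap-cong (insertions-map-suc x) P ⟩
  concatMap (map (map suc) ∘ insertions x) P
    ≡⟨ map-concatMap (map suc) (insertions x) P ⟨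
  map (map suc) (concatMap (insertions x) P)
    ∎
  where
  open ≡-Reasoning
  P = permutations xs

count-map-map-suc : ∀ c ws → count c (map (map suc) ws) ≡ count c ws
count-map-map-suc c []       = refl
count-map-map-suc c (w ∷ ws) = cong₂ _+_ (cong (λ a → δ a c) (ascents-map-suc w)) (count-map-map-suc c ws)

eulerian≡count : ∀ n c → eulerian n c ≡ count c (permutations (oneTo n))
eulerian≡count n c = length-filter≡count c (permutations (oneTo n))

eulerian≡count-shifted : ∀ n c → eulerian n c ≡ count c (permutations (map suc (oneTo n)))
eulerian≡count-shifted n c = begin
  eulerian n c                                     ≡⟨ eulerian≡count n c ⟩
  count c (permutations (oneTo n))                 ≡⟨ count-map-map-suc c (permutations (oneTo n)) ⟨
  count c (map (map suc) (permutations (oneTo n))) ≡⟨ cong (count c) (permutations-map-suc (oneTo n)) ⟨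
  count c (permutations (map suc (oneTo n)))       ∎
  where open ≡-Reasoning

oneTo-suc : ∀ n → oneTo (suc n) ≡ 1 ∷ map suc (oneTo n)
oneTo-suc n = cong (λ xs → 1 ∷ map suc xs) (sym (map-applyUpTo (λ i → i) suc n))

1<shifted-oneTo : ∀ n → All (1 <_) (map suc (oneTo n))
1<shifted-oneTo n = map⁺ (map⁺ (All.universal (λ _ → s≤s (s≤s z≤n)) (upTo n)))

length-shifted-oneTo : ∀ n → length (map suc (oneTo n)) ≡ n
length-shifted-oneTo n = trans (length-map suc (oneTo n)) (trans (length-map suc (upTo n)) (length-applyUpTo _ n))

eulerian-zero : ∀ c → eulerian 0 c ≡ δ 0 c
eulerian-zero c = trans (eulerian≡count 0 c) (+-identityʳ (δ 0 c))

eulerian-suc-zero : ∀ n → eulerian (suc n) 0 ≡ eulerian n 0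
eulerian-suc-zero n = begin
  eulerian (suc n) 0                             ≡⟨ eulerian≡count (suc n) 0 ⟩
  count 0 (permutations (oneTo (suc n)))         ≡⟨ cong (count 0 ∘ permutations) (oneTo-suc n) ⟩
  count 0 (permutations (1 ∷ map suc (oneTo n))) ≡⟨ count-permutations-cons-zero 1 (1<shifted-oneTo n) ⟩
  count 0 (permutations (map suc (oneTo n)))     ≡⟨ eulerian≡count-shifted n 0 ⟨
  eulerian n 0                                   ∎
  where open ≡-Reasoning

eulerian-suc-suc : ∀ n c →
  eulerian (suc n) (suc c) ≡ suc (suc c) * eulerian n (suc c) + (n ∸ c) * eulerian n c
eulerian-suc-suc n c = begin
  eulerian (suc n) (suc c)
    ≡⟨ eulerian≡count (suc n) (suc c) ⟩
  count (suc c) (permutations (oneTo (suc n)))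
    ≡⟨ cong (count (suc c) ∘ permutations) (oneTo-suc n) ⟩
  count (suc c) (permutations (1 ∷ ys))
    ≡⟨ count-permutations-cons-suc 1 (1<shifted-oneTo n) c ⟩
  suc (suc c) * count (suc c) P + (length ys ∸ c) * count c P
    ≡⟨ cong₂ (λ m e → suc (suc c) * e + (m ∸ c) * count c P)
             (length-shifted-oneTo n) (sym (eulerian≡count-shifted n (suc c))) ⟩
  suc (suc c) * eulerian n (suc c) + (n ∸ c) * count c P
    ≡⟨ cong (λ e → suc (suc c) * eulerian n (suc c) + (n ∸ c) * e) (eulerian≡count-shifted n c) ⟨
  suc (suc c) * eulerian n (suc c) + (n ∸ c) * eulerian n c
    ∎
  where
  open ≡-Reasoning
  ys = map suc (oneTo n)
  P = permutations ys

^-distribʳ-* : ∀ m n o → (m * n) ^ o ≡ m ^ o * n ^ o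
^-distribʳ-* m n zero    = refl
^-distribʳ-* m n (suc o) = trans (cong (m * n *_) (^-distribʳ-* m n o)) (regroup m n (m ^ o) (n ^ o))
  where
  regroup : ∀ a b x y → a * b * (x * y) ≡ a * x * (b * y)
  regroup = solve-∀

4*b<a*a⇒2*b<a*[a∸1] : ∀ {a b} → 2 ≤ a → 4 * b < a * a → 2 * b < a * (a ∸ 1)
4*b<a*a⇒2*b<a*[a∸1] {b = b} (s≤s (s≤s {n = m} z≤n)) 4b<a*a = *-cancelˡ-< 2 (2 * b) (a * suc m) (begin-strict
  2 * (2 * b)      ≡⟨ *-assoc 2 2 b ⟨
  4 * b            <⟨ 4b<a*a ⟩
  a * a            ≤⟨ *-monoʳ-≤ a (m≤n+m a m) ⟩
  a * (m + a)      ≡⟨ regroup m ⟩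
  2 * (a * suc m)  ∎)
  where
  open ≤-Reasoning
  a = suc (suc m)
  regroup : ∀ m → (2 + m) * (m + (2 + m)) ≡ 2 * ((2 + m) * (1 + m))
  regroup = solve-∀

2+3k≤[1+k]² : ∀ {k} → 2 ≤ k → 2 + 3 * k ≤ suc k * suc k
2+3k≤[1+k]² 2≤k with m≤n⇒∃[o]m+o≡n 2≤k
... | j , refl = subst (2 + 3 * (2 + j) ≤_) (expand j) (m≤m+n (2 + 3 * (2 + j)) (1 + 3 * j + j * j))
  where
  expand : ∀ j → 2 + 3 * (2 + j) + (1 + 3 * j + j * j) ≡ (3 + j) * (3 + j)
  expand = solve-∀

4<[1+k]^[k+t] : ∀ {k} t → 2 ≤ k → 4 < suc k ^ (k + t)
4<[1+k]^[k+t] {k} t 2≤k = begin-strict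
  4                <⟨ <ᵇ⇒< 4 9 _ ⟩
  3 ^ 2            ≤⟨ ^-monoˡ-≤ 2 (s≤s 2≤k) ⟩
  suc k ^ 2        ≤⟨ ^-monoʳ-≤ (suc k) (≤-trans 2≤k (m≤m+n k t)) ⟩
  suc k ^ (k + t)  ∎
  where open ≤-Reasoning

108*81^k<[1+k]^[1+2k] : ∀ k → 12 ≤ k → 108 * 81 ^ k < suc k ^ suc (k + k)
108*81^k<[1+k]^[1+2k] k 12≤k =
  subst (λ k → 108 * 81 ^ k < suc k ^ suc (k + k)) (trans (+-comm (k ∸ 12) 12) (m+[n∸m]≡n 12≤k)) (from-12 (k ∸ 12))
  where
  step : ∀ k → 7 ≤ k → 108 * 81 ^ k < suc k ^ suc (k + k) →
         108 * 81 ^ suc k < suc (suc k) ^ suc (suc k + suc k)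
  step k 7≤k ih = begin-strict
    108 * (81 * 81 ^ k)        ≡⟨ *-comm-middle 108 81 (81 ^ k) ⟩
    81 * (108 * 81 ^ k)        <⟨ *-monoʳ-< 81 ih ⟩
    81 * X ^ e                 ≤⟨ *-monoˡ-≤ (X ^ e) (*-mono-≤ 9≤1+X 9≤1+X) ⟩
    suc X * suc X * X ^ e      ≤⟨ *-monoʳ-≤ (suc X * suc X) (^-monoˡ-≤ e (n≤1+n X)) ⟩
    suc X * suc X * suc X ^ e  ≡⟨ trans (*-assoc (suc X) (suc X) (suc X ^ e)) (cong (suc X ^_) (exponent k)) ⟩
    suc X ^ suc (X + X)        ∎
    where
    open ≤-Reasoning
    X = suc k
    e = suc (k + k)
    9≤1+X : 9 ≤ suc X
    9≤1+X = s≤s (s≤s 7≤k)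
    *-comm-middle : ∀ p c y → p * (c * y) ≡ c * (p * y)
    *-comm-middle = solve-∀
    exponent : ∀ k → suc (suc (suc (k + k))) ≡ suc (suc k + suc k)
    exponent = solve-∀
  -- Indexed by d + 12 rather than 12 + d: the latter would let the type checker unfold 81 ^ 12 symbolically.
  from-12 : ∀ d → 108 * 81 ^ (d + 12) < suc (d + 12) ^ suc (d + 12 + (d + 12))
  from-12 zero    = <ᵇ⇒< (108 * 81 ^ 12) (13 ^ 25) _
  from-12 (suc d) = step (d + 12) (≤-trans (m≤n+m 7 d) (+-monoʳ-≤ d (m≤m+n 7 5))) (from-12 d)

-- binom n d = C(n + d, d), given by Pascal's rule.
binom : ℕ → ℕ → ℕ
binom zero    d       = 1
binom (suc n) zero    = 1
binom (suc n) (suc d) = binom n (suc d) + binom (suc n) d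

binom-n-zero : ∀ n → binom n 0 ≡ 1
binom-n-zero zero    = refl
binom-n-zero (suc n) = refl

mutual
  binom-absorbˡ : ∀ n d → suc d * binom n (suc d) ≡ (n + suc d) * binom n d
  binom-absorbˡ zero    d = refl
  binom-absorbˡ (suc n) d = begin
    suc d * (binom n (suc d) + binom (suc n) d)        ≡⟨ *-distribˡ-+ (suc d) (binom n (suc d)) _ ⟩
    suc d * binom n (suc d) + suc d * binom (suc n) d  ≡⟨ cong (_+ suc d * binom (suc n) d) (binom-absorbˡ n d) ⟩
    (n + suc d) * binom n d + suc d * binom (suc n) d  ≡⟨ cong (λ k → k * binom n d + suc d * binom (suc n) d) (+-suc n d) ⟩
    (suc n + d) * binom n d + suc d * binom (suc n) d  ≡⟨ cong (_+ suc d * binom (suc n) d) (binom-absorbʳ n d) ⟨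
    suc n * binom (suc n) d + suc d * binom (suc n) d  ≡⟨ *-distribʳ-+ (binom (suc n) d) (suc n) (suc d) ⟨
    (suc n + suc d) * binom (suc n) d                  ∎
    where open ≡-Reasoning

  binom-absorbʳ : ∀ n d → suc n * binom (suc n) d ≡ (suc n + d) * binom n d
  binom-absorbʳ n zero    = cong₂ _*_ (sym (+-identityʳ (suc n))) (sym (binom-n-zero n))
  binom-absorbʳ n (suc d) = begin
    suc n * (binom n (suc d) + binom (suc n) d)        ≡⟨ *-distribˡ-+ (suc n) (binom n (suc d)) _ ⟩
    suc n * binom n (suc d) + suc n * binom (suc n) d  ≡⟨ cong (suc n * binom n (suc d) +_) (binom-absorbʳ n d) ⟩
    suc n * binom n (suc d) + (suc n + d) * binom n d  ≡⟨ cong (λ k → suc n * binom n (suc d) + k * binom n d) (+-suc n d) ⟨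
    suc n * binom n (suc d) + (n + suc d) * binom n d  ≡⟨ cong (suc n * binom n (suc d) +_) (binom-absorbˡ n d) ⟨
    suc n * binom n (suc d) + suc d * binom n (suc d)  ≡⟨ *-distribʳ-+ (binom n (suc d)) (suc n) (suc d) ⟨
    (suc n + suc d) * binom n (suc d)                  ∎
    where open ≡-Reasoning

binom-absorb : ∀ n d → suc n * binom (suc n) d ≡ suc d * binom n (suc d)
binom-absorb n d =
  trans (binom-absorbʳ n d) (trans (cong (_* binom n d) (sym (+-suc n d))) (sym (binom-absorbˡ n d)))

-- weight n m i = C(n + m − i, n) for i ≤ m and 0 for i > m, the coefficient of A(n, i) in Worpitzky's identity.
weight : ℕ → ℕ → ℕ → ℕ
weight n zero    zero    = 1
weight n zero    (suc i) = 0
weight n (suc m) zero    = binom n (suc m)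
weight n (suc m) (suc i) = weight n m i

weight-+ : ∀ n i d → weight n (i + d) i ≡ binom n d
weight-+ n zero    zero    = sym (binom-n-zero n)
weight-+ n zero    (suc d) = refl
weight-+ n (suc i) d       = weight-+ n i d

weight-> : ∀ n m i → m < i → weight n m i ≡ 0
weight-> n zero    (suc i) _         = refl
weight-> n (suc m) (suc i) (s≤s m<i) = weight-> n m i m<i

weight-diag : ∀ n i → weight n i i ≡ 1
weight-diag n zero    = refl
weight-diag n (suc i) = weight-diag n i

weight-zero-index : ∀ n m → weight n m 0 ≡ binom n m
weight-zero-index n zero    = sym (binom-n-zero n)
weight-zero-index n (suc m) = refl

weight-recurrence : ∀ N m i → i ≤ N →
  suc i * weight (suc N) m i + (N ∸ i) * weight (suc N) m (suc i) ≡ suc m * weight N m i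
weight-recurrence N m i i≤N with m <? i | m≤n⇒∃[o]m+o≡n i≤N
... | yes m<i | _ rewrite weight-> (suc N) m i m<i | weight-> (suc N) m (suc i) (m≤n⇒m≤1+n m<i) | weight-> N m i m<i
                        | *-zeroʳ (suc i) | *-zeroʳ (N ∸ i) | *-zeroʳ (suc m) = refl
... | no m≮i | j , refl with m≤n⇒∃[o]m+o≡n (≮⇒≥ m≮i)
...   | zero  , refl rewrite +-identityʳ i | weight-diag (suc (i + j)) i | weight-diag (i + j) i
                           | weight-> (suc (i + j)) i (suc i) ≤-refl | *-zeroʳ (i + j ∸ i) = cong suc (+-identityʳ (i * 1))
...   | suc e , refl = begin
  suc i * weight (suc N) (i + suc e) i + (N ∸ i) * weight (suc N) (i + suc e) (suc i)
    ≡⟨ cong₂ (λ u v → suc i * u + v) (weight-+ (suc N) i (suc e)) (cong₂ _*_ (m+n∸m≡n i j) (weight-suc (suc N))) ⟩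
  suc i * (binom N (suc e) + binom (suc N) e) + j * binom (suc N) e
    ≡⟨ regroup (suc i) j (binom N (suc e)) (binom (suc N) e) ⟩
  suc i * binom N (suc e) + suc N * binom (suc N) e
    ≡⟨ cong (suc i * binom N (suc e) +_) (binom-absorb N e) ⟩
  suc i * binom N (suc e) + suc e * binom N (suc e)
    ≡⟨ *-distribʳ-+ (binom N (suc e)) (suc i) (suc e) ⟨
  suc (i + suc e) * binom N (suc e)
    ≡⟨ cong (suc (i + suc e) *_) (weight-+ N i (suc e)) ⟨
  suc (i + suc e) * weight N (i + suc e) i
    ∎
  where
  open ≡-Reasoning
  weight-suc : ∀ n → weight n (i + suc e) (suc i) ≡ binom n e
  weight-suc n = trans (cong (λ k → weight n k (suc i)) (+-suc i e)) (weight-+ n i e)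
  regroup : ∀ a j x y → a * (x + y) + j * y ≡ a * x + (a + j) * y
  regroup = solve-∀

sumBelow : ℕ → (ℕ → ℕ) → ℕ
sumBelow zero    f = 0
sumBelow (suc r) f = f 0 + sumBelow r (f ∘ suc)

sumBelow-cong : ∀ r {f g : ℕ → ℕ} → (∀ i → f i ≡ g i) → sumBelow r f ≡ sumBelow r g
sumBelow-cong zero    f≗g = refl
sumBelow-cong (suc r) f≗g = cong₂ _+_ (f≗g 0) (sumBelow-cong r (f≗g ∘ suc))

sumBelow-zero : ∀ r {f : ℕ → ℕ} → (∀ i → f i ≡ 0) → sumBelow r f ≡ 0
sumBelow-zero zero    f≗0 = refl
sumBelow-zero (suc r) f≗0 = cong₂ _+_ (f≗0 0) (sumBelow-zero r (f≗0 ∘ suc))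

sumBelow-+ : ∀ r (f g : ℕ → ℕ) → sumBelow r (λ i → f i + g i) ≡ sumBelow r f + sumBelow r g
sumBelow-+ zero    f g = refl
sumBelow-+ (suc r) f g = trans (cong (f 0 + g 0 +_) (sumBelow-+ r (f ∘ suc) (g ∘ suc)))
                               (regroup (f 0) (g 0) (sumBelow r (f ∘ suc)) (sumBelow r (g ∘ suc)))
  where
  regroup : ∀ a b c d → a + b + (c + d) ≡ a + c + (b + d)
  regroup = solve-∀

sumBelow-* : ∀ r k (f : ℕ → ℕ) → sumBelow r (λ i → k * f i) ≡ k * sumBelow r f
sumBelow-* zero    k f = sym (*-zeroʳ k)
sumBelow-* (suc r) k f = trans (cong (k * f 0 +_) (sumBelow-* r k (f ∘ suc))) (sym (*-distribˡ-+ k (f 0) _))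

sumBelow-suc : ∀ r (f : ℕ → ℕ) → sumBelow (suc r) f ≡ sumBelow r f + f r
sumBelow-suc zero    f = +-identityʳ (f 0)
sumBelow-suc (suc r) f = trans (cong (f 0 +_) (sumBelow-suc r (f ∘ suc))) (sym (+-assoc (f 0) _ _))

term≤sumBelow : ∀ r (f : ℕ → ℕ) i → i < r → f i ≤ sumBelow r f
term≤sumBelow (suc r) f zero    _         = m≤m+n (f 0) _
term≤sumBelow (suc r) f (suc i) (s≤s i<r) = ≤-trans (term≤sumBelow r (f ∘ suc) i i<r) (m≤n+m _ (f 0))

entry : List ℕ → ℕ → ℕ
entry []       _       = 0
entry (x ∷ _)  zero    = x
entry (_ ∷ xs) (suc c) = entry xs c

entry-applyUpTo : ∀ (f : ℕ → ℕ) m c → c < m → entry (applyUpTo f m) c ≡ f c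
entry-applyUpTo f (suc m) zero    _         = refl
entry-applyUpTo f (suc m) (suc c) (s≤s c<m) = entry-applyUpTo (f ∘ suc) m c c<m

entry-≥length : ∀ xs c → length xs ≤ c → entry xs c ≡ 0
entry-≥length []       c       _        = refl
entry-≥length (x ∷ xs) (suc c) (s≤s le) = entry-≥length xs c le

nextRowEntry : ℕ → List ℕ → ℕ → ℕ
nextRowEntry n row zero    = entry row 0
nextRowEntry n row (suc c) = suc (suc c) * entry row (suc c) + (n ∸ c) * entry row c

-- Lets concrete values A(n, c) be evaluated without enumerating permutations.
eulerianRow : ℕ → List ℕ
eulerianRow zero    = 1 ∷ []
eulerianRow (suc n) = applyUpTo (nextRowEntry n (eulerianRow n)) (suc (suc n))

length-eulerianRow : ∀ n → length (eulerianRow n) ≡ suc n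
length-eulerianRow zero    = refl
length-eulerianRow (suc n) = length-applyUpTo (nextRowEntry n (eulerianRow n)) (suc (suc n))

eulerianRow-suc-suc : ∀ n c → entry (eulerianRow (suc n)) (suc c) ≡
  suc (suc c) * entry (eulerianRow n) (suc c) + (n ∸ c) * entry (eulerianRow n) c
eulerianRow-suc-suc n c with suc c <? suc (suc n)
... | yes c<n+1 = entry-applyUpTo (nextRowEntry n (eulerianRow n)) (suc (suc n)) (suc c) c<n+1
... | no  c≮n+1 = begin
  entry (eulerianRow (suc n)) (suc c)
    ≡⟨ entry-≥length (eulerianRow (suc n)) (suc c) (≤-trans (≤-reflexive (length-eulerianRow (suc n))) (s≤s n+1≤c)) ⟩
  0
    ≡⟨ trans (+-identityʳ _) (*-zeroʳ (suc (suc c))) ⟨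
  suc (suc c) * 0 + 0 * entry (eulerianRow n) c
    ≡⟨ cong₂ (λ e d → suc (suc c) * e + d * entry (eulerianRow n) c)
             (entry-≥length (eulerianRow n) (suc c) (≤-trans (≤-reflexive (length-eulerianRow n)) (m≤n⇒m≤1+n n+1≤c)))
             (m≤n⇒m∸n≡0 (<⇒≤ n+1≤c)) ⟨
  suc (suc c) * entry (eulerianRow n) (suc c) + (n ∸ c) * entry (eulerianRow n) c
    ∎
  where
  open ≡-Reasoning
  n+1≤c : suc n ≤ c
  n+1≤c = ≤-pred (≮⇒≥ c≮n+1)

-- Everything below uses nothing but the recurrence. Keeping A abstract also stops the type
-- checker from unfolding eulerian into its list of permutations when comparing types.
module FromRecurrence
  (A : ℕ → ℕ → ℕ)
  (A-zero : ∀ c → A 0 c ≡ δ 0 c)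
  (A-suc-zero : ∀ n → A (suc n) 0 ≡ A n 0)
  (A-suc-suc : ∀ n c → A (suc n) (suc c) ≡ suc (suc c) * A n (suc c) + (n ∸ c) * A n c)
  where

  A-n-zero : ∀ n → A n 0 ≡ 1
  A-n-zero zero    = A-zero 0
  A-n-zero (suc n) = trans (A-suc-zero n) (A-n-zero n)

  A-vanishes : ∀ n c → n ≤ suc c → A n (suc c) ≡ 0
  A-vanishes zero    c _         = A-zero (suc c)
  A-vanishes (suc n) c (s≤s n≤c) = begin
    A (suc n) (suc c)
      ≡⟨ A-suc-suc n c ⟩
    suc (suc c) * A n (suc c) + (n ∸ c) * A n c
      ≡⟨ cong₂ (λ e d → suc (suc c) * e + d * A n c) (A-vanishes n c (m≤n⇒m≤1+n n≤c)) (m≤n⇒m∸n≡0 n≤c) ⟩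
    suc (suc c) * 0 + 0
      ≡⟨ trans (+-identityʳ _) (*-zeroʳ (suc (suc c))) ⟩
    0
      ∎
    where open ≡-Reasoning

  A-top : ∀ m → A (suc m) m ≡ 1
  A-top zero    = A-n-zero 1
  A-top (suc m) = begin
    A (suc (suc m)) (suc m)
      ≡⟨ A-suc-suc (suc m) m ⟩
    suc (suc m) * A (suc m) (suc m) + (suc m ∸ m) * A (suc m) m
      ≡⟨ cong₂ (λ e d → suc (suc m) * e + d) (A-vanishes (suc m) m ≤-refl) (cong₂ _*_ (m+n∸n≡m 1 m) (A-top m)) ⟩
    suc (suc m) * 0 + 1
      ≡⟨ cong (_+ 1) (*-zeroʳ (suc (suc m))) ⟩
    1
      ∎
    where open ≡-Reasoning

  suc-*-A≤ : ∀ n c → suc c * A n c ≤ A (suc n) c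
  suc-*-A≤ n zero    = ≤-reflexive (trans (+-identityʳ (A n 0)) (sym (A-suc-zero n)))
  suc-*-A≤ n (suc c) = ≤-trans (m≤m+n _ _) (≤-reflexive (sym (A-suc-suc n c)))

  A-lower-bound : ∀ k j → suc k ^ j ≤ A (suc k + j) k
  A-lower-bound k zero    = ≤-reflexive (sym (trans (cong (λ n → A n k) (+-identityʳ (suc k))) (A-top k)))
  A-lower-bound k (suc j) = begin
    suc k * suc k ^ j        ≤⟨ *-monoʳ-≤ (suc k) (A-lower-bound k j) ⟩
    suc k * A (suc k + j) k  ≤⟨ suc-*-A≤ (suc k + j) k ⟩
    A (suc (suc k + j)) k    ≡⟨ cong (λ n → A n k) (+-suc (suc k) j) ⟨
    A (suc k + suc j) k      ∎
    where open ≤-Reasoning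

  A-square-lower-bound : ∀ k j → suc k ^ (j + j) ≤ A (suc k + j) k * A (suc k + j) k
  A-square-lower-bound k j = begin
    suc k ^ (j + j)                    ≡⟨ ^-distribˡ-+-* (suc k) j j ⟩
    suc k ^ j * suc k ^ j              ≤⟨ *-mono-≤ (A-lower-bound k j) (A-lower-bound k j) ⟩
    A (suc k + j) k * A (suc k + j) k  ∎
    where open ≤-Reasoning

  2≤A : ∀ {k n} → 0 < k → suc (suc k) ≤ n → 2 ≤ A n k
  2≤A {k} 0<k k+2≤n with m≤n⇒∃[o]m+o≡n k+2≤n
  ... | j , refl = begin
    2                      ≤⟨ s≤s 0<k ⟩
    suc k                  ≡⟨ *-identityʳ (suc k) ⟨
    suc k * 1              ≤⟨ *-monoʳ-≤ (suc k) (m^n>0 (suc k) j) ⟩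
    suc k ^ suc j          ≤⟨ A-lower-bound k (suc j) ⟩
    A (suc k + suc j) k    ≡⟨ cong (λ n → A n k) (+-suc (suc k) j) ⟩
    A (suc (suc k) + j) k  ∎
    where open ≤-Reasoning

  A-symmetric : ∀ m p q → p + q ≡ m → A (suc m) p ≡ A (suc m) q
  A-symmetric m zero    q       refl = trans (A-n-zero (suc q)) (sym (A-top q))
  A-symmetric m (suc p) zero    refl = begin
    A (suc (suc p + 0)) (suc p)  ≡⟨ cong (λ n → A (suc n) (suc p)) (+-identityʳ (suc p)) ⟩
    A (suc (suc p)) (suc p)      ≡⟨ A-top (suc p) ⟩
    1                            ≡⟨ A-n-zero (suc (suc p + 0)) ⟨
    A (suc (suc p + 0)) 0        ∎
    where open ≡-Reasoning
  A-symmetric zero    (suc p) (suc q) ()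
  A-symmetric (suc m) (suc p) (suc q) p+q≡m = begin
    A (suc (suc m)) (suc p)
      ≡⟨ A-suc-suc (suc m) p ⟩
    suc (suc p) * A (suc m) (suc p) + (suc m ∸ p) * A (suc m) p
      ≡⟨ cong₂ (λ e d → suc (suc p) * e + d * A (suc m) p) (A-symmetric m (suc p) q sp+q≡m) m∸p ⟩
    suc (suc p) * A (suc m) q + suc (suc q) * A (suc m) p
      ≡⟨ cong (λ e → suc (suc p) * A (suc m) q + suc (suc q) * e) (A-symmetric m p (suc q) p+sq≡m) ⟩
    suc (suc p) * A (suc m) q + suc (suc q) * A (suc m) (suc q)
      ≡⟨ +-comm (suc (suc p) * A (suc m) q) _ ⟩
    suc (suc q) * A (suc m) (suc q) + suc (suc p) * A (suc m) q
      ≡⟨ cong (λ d → suc (suc q) * A (suc m) (suc q) + d * A (suc m) q) m∸q ⟨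
    suc (suc q) * A (suc m) (suc q) + (suc m ∸ q) * A (suc m) q
      ≡⟨ A-suc-suc (suc m) q ⟨
    A (suc (suc m)) (suc q)
      ∎
    where
    open ≡-Reasoning
    p+sq≡m : p + suc q ≡ m
    p+sq≡m = suc-injective p+q≡m
    sp+q≡m : suc p + q ≡ m
    sp+q≡m = trans (sym (+-suc p q)) p+sq≡m
    m∸p : suc m ∸ p ≡ suc (suc q)
    m∸p = trans (cong (λ n → suc n ∸ p) (sym p+sq≡m)) (trans (cong (_∸ p) (sym (+-suc p (suc q)))) (m+n∸m≡n p _))
    m∸q : suc m ∸ q ≡ suc (suc p)
    m∸q = trans (cong (λ n → suc n ∸ q) (sym sp+q≡m)) (m+n∸n≡m (suc (suc p)) q)

  sumBelow-A-suc : ∀ N R (f : ℕ → ℕ) →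
    sumBelow (suc R) (λ i → A (suc N) i * f i) ≡
    sumBelow (suc R) (λ i → suc i * A N i * f i) + sumBelow R (λ i → (N ∸ i) * A N i * f (suc i))
  sumBelow-A-suc N R f = begin
    A (suc N) 0 * f 0 + sumBelow R (λ p → A (suc N) (suc p) * f (suc p))
      ≡⟨ cong₂ _+_ (cong (_* f 0) (trans (A-suc-zero N) (sym (*-identityˡ _)))) (sumBelow-cong R recurrence) ⟩
    1 * A N 0 * f 0 + sumBelow R (λ p → g (suc p) + h p)
      ≡⟨ cong (1 * A N 0 * f 0 +_) (sumBelow-+ R (g ∘ suc) h) ⟩
    1 * A N 0 * f 0 + (sumBelow R (g ∘ suc) + sumBelow R h)
      ≡⟨ +-assoc (1 * A N 0 * f 0) _ _ ⟨
    sumBelow (suc R) g + sumBelow R h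
      ∎
    where
    open ≡-Reasoning
    g h : ℕ → ℕ
    g i = suc i * A N i * f i
    h i = (N ∸ i) * A N i * f (suc i)
    recurrence : ∀ p → A (suc N) (suc p) * f (suc p) ≡ g (suc p) + h p
    recurrence p = trans (cong (_* f (suc p)) (A-suc-suc N p)) (*-distribʳ-+ (f (suc p)) (suc (suc p) * A N (suc p)) _)

  worpitzky-term : ∀ N m i →
    suc i * A N i * weight (suc N) m i + (N ∸ i) * A N i * weight (suc N) m (suc i)
      ≡ suc m * (A N i * weight N m i)
  worpitzky-term N m i = begin
    suc i * a * x + (N ∸ i) * a * y  ≡⟨ factorˡ (suc i) a x (N ∸ i) y ⟩
    a * (suc i * x + (N ∸ i) * y)    ≡⟨ scaled-weight-recurrence i ⟩
    a * (suc m * z)                  ≡⟨ factorʳ a (suc m) z ⟩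
    suc m * (a * z)                  ∎
    where
    open ≡-Reasoning
    a = A N i
    x = weight (suc N) m i
    y = weight (suc N) m (suc i)
    z = weight N m i
    factorˡ : ∀ p a x q y → p * a * x + q * a * y ≡ a * (p * x + q * y)
    factorˡ = solve-∀
    factorʳ : ∀ a p z → a * (p * z) ≡ p * (a * z)
    factorʳ = solve-∀
    scaled-weight-recurrence : ∀ i → A N i * (suc i * weight (suc N) m i + (N ∸ i) * weight (suc N) m (suc i))
                                     ≡ A N i * (suc m * weight N m i)
    scaled-weight-recurrence i with i ≤? N
    scaled-weight-recurrence i       | yes i≤N = cong (A N i *_) (weight-recurrence N m i i≤N)
    scaled-weight-recurrence zero    | no  0≰N = contradiction z≤n 0≰N
    scaled-weight-recurrence (suc c) | no  i≰N rewrite A-vanishes N c (≰⇒≥ i≰N) = refl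

  worpitzky : ∀ n R m → n < R → sumBelow R (λ i → A n i * weight n m i) ≡ suc m ^ n
  worpitzky zero (suc R) m _ =
    cong₂ _+_ (trans (cong (_* weight 0 m 0) (A-zero 0)) (trans (*-identityˡ _) (weight-zero-index 0 m)))
              (sumBelow-zero R (λ i → cong (_* weight 0 m (suc i)) (A-zero (suc i))))
  worpitzky (suc N) (suc R) m (s≤s N<R) = begin
    sumBelow (suc R) (λ i → A (suc N) i * weight (suc N) m i)
      ≡⟨ sumBelow-A-suc N R (weight (suc N) m) ⟩
    sumBelow (suc R) g + sumBelow R h
      ≡⟨ cong (sumBelow (suc R) g +_) (trans (cong (sumBelow R h +_) h-R≡0) (+-identityʳ _)) ⟨
    sumBelow (suc R) g + (sumBelow R h + h R)
      ≡⟨ cong (sumBelow (suc R) g +_) (sumBelow-suc R h) ⟨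
    sumBelow (suc R) g + sumBelow (suc R) h
      ≡⟨ sumBelow-+ (suc R) g h ⟨
    sumBelow (suc R) (λ i → g i + h i)
      ≡⟨ sumBelow-cong (suc R) (worpitzky-term N m) ⟩
    sumBelow (suc R) (λ i → suc m * (A N i * weight N m i))
      ≡⟨ sumBelow-* (suc R) (suc m) (λ i → A N i * weight N m i) ⟩
    suc m * sumBelow (suc R) (λ i → A N i * weight N m i)
      ≡⟨ cong (suc m *_) (worpitzky N (suc R) m (m≤n⇒m≤1+n N<R)) ⟩
    suc m * suc m ^ N
      ∎
    where
    open ≡-Reasoning
    g h : ℕ → ℕ
    g i = suc i * A N i * weight (suc N) m i
    h i = (N ∸ i) * A N i * weight (suc N) m (suc i)
    h-R≡0 : h R ≡ 0
    h-R≡0 rewrite m≤n⇒m∸n≡0 (<⇒≤ N<R) = refl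

  A-upper-bound : ∀ n m → A n m ≤ suc m ^ n
  A-upper-bound n m = begin
    A n m                                    ≡⟨ *-identityʳ _ ⟨
    A n m * 1                                ≡⟨ cong (A n m *_) (weight-diag n m) ⟨
    A n m * weight n m m                     ≤⟨ term≤sumBelow R (λ i → A n i * weight n m i) m (s≤s (m≤n+m m n)) ⟩
    sumBelow R (λ i → A n i * weight n m i)  ≡⟨ worpitzky n R m (s≤s (m≤m+n n m)) ⟩
    suc m ^ n                                ∎
    where
    open ≤-Reasoning
    R = suc (n + m)

  A≡entry : ∀ n c → A n c ≡ entry (eulerianRow n) c
  A≡entry zero    zero    = A-zero 0
  A≡entry zero    (suc c) = A-zero (suc c)
  A≡entry (suc n) zero    = trans (A-suc-zero n) (A≡entry n 0)
  A≡entry (suc n) (suc c) = begin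
    A (suc n) (suc c)
      ≡⟨ A-suc-suc n c ⟩
    suc (suc c) * A n (suc c) + (n ∸ c) * A n c
      ≡⟨ cong₂ (λ e d → suc (suc c) * e + (n ∸ c) * d) (A≡entry n (suc c)) (A≡entry n c) ⟩
    suc (suc c) * entry (eulerianRow n) (suc c) + (n ∸ c) * entry (eulerianRow n) c
      ≡⟨ eulerianRow-suc-suc n c ⟨
    entry (eulerianRow (suc n)) (suc c)
      ∎
    where open ≡-Reasoning

  EulerianInequality : ℕ → ℕ → Set
  EulerianInequality k n = 2 * A n (suc (3 * k)) < A n k * (A n k ∸ 1)

  PowerBound : ℕ → ℕ → Set
  PowerBound k n = 4 * (2 + 3 * k) ^ n < A n k * A n k

  inequality-from-bound : ∀ {k n} → 0 < k → suc (suc k) ≤ n →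
    4 * A n (suc (3 * k)) < A n k * A n k → EulerianInequality k n
  inequality-from-bound {k} {n} 0<k k+2≤n =
    4*b<a*a⇒2*b<a*[a∸1] {A n k} {A n (suc (3 * k))} (2≤A 0<k k+2≤n)

  inequality-from-power : ∀ {k n} → 0 < k → suc (suc k) ≤ n → PowerBound k n → EulerianInequality k n
  inequality-from-power {k} {n} 0<k k+2≤n bound =
    inequality-from-bound 0<k k+2≤n (≤-<-trans (*-monoʳ-≤ 4 (A-upper-bound n (suc (3 * k)))) bound)

  powerBound-suc : ∀ {k n} → 2 ≤ k → PowerBound k n → PowerBound k (suc n)
  powerBound-suc {k} {n} 2≤k bound = begin-strict
    4 * (C * C ^ n)            ≡⟨ *-comm-middle 4 C (C ^ n) ⟩
    C * (4 * C ^ n)            ≤⟨ *-monoˡ-≤ (4 * C ^ n) (2+3k≤[1+k]² 2≤k) ⟩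
    X * X * (4 * C ^ n)        <⟨ *-monoʳ-< (X * X) bound ⟩
    X * X * (a * a)            ≡⟨ regroup X a ⟩
    (X * a) * (X * a)          ≤⟨ *-mono-≤ (suc-*-A≤ n k) (suc-*-A≤ n k) ⟩
    A (suc n) k * A (suc n) k  ∎
    where
    open ≤-Reasoning
    C = 2 + 3 * k
    X = suc k
    a = A n k
    *-comm-middle : ∀ p c y → p * (c * y) ≡ c * (p * y)
    *-comm-middle = solve-∀
    regroup : ∀ x a → x * x * (a * a) ≡ (x * a) * (x * a)
    regroup = solve-∀

  powerBound-+ : ∀ {k n} → 2 ≤ k → PowerBound k n → ∀ t → PowerBound k (n + t)
  powerBound-+ {k} {n} 2≤k bound zero    = subst (PowerBound k) (sym (+-identityʳ n)) bound
  powerBound-+ {k} {n} 2≤k bound (suc t) =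
    subst (PowerBound k) (sym (+-suc n t)) (powerBound-suc {n = n + t} 2≤k (powerBound-+ {n = n} 2≤k bound t))

  -- For 3k + 2 ≤ n ≤ 4k + 2 the symmetry A(n, 3k + 1) = A(n, n − 3k − 2) gives the small bound (k + 1)^n.
  inequality-near : ∀ k t → 2 ≤ k → t ≤ k → EulerianInequality k (2 + 3 * k + t)
  inequality-near k t 2≤k t≤k = inequality-from-bound (≤-trans (s≤s z≤n) 2≤k) k+2≤n (begin-strict
    4 * A n (suc (3 * k))      ≡⟨ cong (4 *_) (A-symmetric (suc (3 * k + t)) (suc (3 * k)) t refl) ⟩
    4 * A n t                  ≤⟨ *-monoʳ-≤ 4 (≤-trans (A-upper-bound n t) (^-monoˡ-≤ n (s≤s t≤k))) ⟩
    4 * X ^ n                  <⟨ *-monoˡ-< (X ^ n) {{m^n≢0 X n}} (4<[1+k]^[k+t] t 2≤k) ⟩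
    X ^ (k + t) * X ^ n        ≡⟨ ^-distribˡ-+-* X (k + t) n ⟨
    X ^ (k + t + n)            ≡⟨ cong (X ^_) (exponent k t) ⟩
    X ^ (j + j)                ≤⟨ A-square-lower-bound k j ⟩
    A (X + j) k * A (X + j) k  ≡⟨ cong (λ m → A m k * A m k) (X+j≡n k t) ⟩
    A n k * A n k              ∎)
    where
    open ≤-Reasoning
    n = 2 + 3 * k + t
    X = suc k
    j = suc (k + k + t)
    k+2≤n : suc (suc k) ≤ n
    k+2≤n = s≤s (s≤s (≤-trans (m≤n*m k 3) (m≤m+n (3 * k) t)))
    exponent : ∀ k t → k + t + (2 + 3 * k + t) ≡ suc (k + k + t) + suc (k + k + t)
    exponent = solve-∀
    X+j≡n : ∀ k t → suc k + suc (k + k + t) ≡ 2 + 3 * k + t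
    X+j≡n = solve-∀

  -- With n = 4k + 3: 4 (3k + 2)^n ≤ 4 · 3^n (k + 1)^n = 108 · 81^k (k + 1)^n, and A(n, k)² ≥ (k + 1)^(6k + 4).
  powerBound-large : ∀ k → 12 ≤ k → PowerBound k (4 * k + 3)
  powerBound-large k 12≤k = begin-strict
    4 * (2 + 3 * k) ^ n        ≤⟨ *-monoʳ-≤ 4 (^-monoˡ-≤ n 2+3k≤3X) ⟩
    4 * (3 * X) ^ n            ≡⟨ cong (4 *_) (^-distribʳ-* 3 X n) ⟩
    4 * (3 ^ n * X ^ n)        ≡⟨ *-assoc 4 (3 ^ n) (X ^ n) ⟨
    4 * 3 ^ n * X ^ n          ≡⟨ cong (_* X ^ n) 4*3^n≡108*81^k ⟩
    108 * 81 ^ k * X ^ n       <⟨ *-monoˡ-< (X ^ n) {{m^n≢0 X n}} (108*81^k<[1+k]^[1+2k] k 12≤k) ⟩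
    X ^ suc (k + k) * X ^ n    ≡⟨ ^-distribˡ-+-* X (suc (k + k)) n ⟨
    X ^ (suc (k + k) + n)      ≡⟨ cong (X ^_) (exponent k) ⟩
    X ^ (j + j)                ≤⟨ A-square-lower-bound k j ⟩
    A (X + j) k * A (X + j) k  ≡⟨ cong (λ m → A m k * A m k) (X+j≡n k) ⟩
    A n k * A n k              ∎
    where
    open ≤-Reasoning
    n = 4 * k + 3
    X = suc k
    j = 2 + 3 * k
    2+3k≤3X : 2 + 3 * k ≤ 3 * X
    2+3k≤3X = subst (2 + 3 * k ≤_) (sym (*-suc 3 k)) (n≤1+n (2 + 3 * k))
    4*3^n≡108*81^k : 4 * 3 ^ n ≡ 108 * 81 ^ k
    4*3^n≡108*81^k = begin-equality
      4 * 3 ^ (4 * k + 3)     ≡⟨ cong (4 *_) (^-distribˡ-+-* 3 (4 * k) 3) ⟩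
      4 * (3 ^ (4 * k) * 27)  ≡⟨ cong (λ p → 4 * (p * 27)) (^-*-assoc 3 4 k) ⟨
      4 * (81 ^ k * 27)       ≡⟨ regroup (81 ^ k) ⟩
      108 * 81 ^ k            ∎
      where
      regroup : ∀ x → 4 * (x * 27) ≡ 108 * x
      regroup = solve-∀
    exponent : ∀ k → suc (k + k) + (4 * k + 3) ≡ (2 + 3 * k) + (2 + 3 * k)
    exponent = solve-∀
    X+j≡n : ∀ k → suc k + (2 + 3 * k) ≡ 4 * k + 3
    X+j≡n = solve-∀

  powerBound-by-computation : ∀ k n →
    T (4 * (2 + 3 * k) ^ n <ᵇ entry (eulerianRow n) k * entry (eulerianRow n) k) → PowerBound k n
  powerBound-by-computation k n check =
    subst (λ a → 4 * (2 + 3 * k) ^ n < a * a) (sym (A≡entry n k)) (<ᵇ⇒< _ _ check)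

  inequality-by-computation : ∀ k n →
    T (2 * entry (eulerianRow n) (suc (3 * k)) <ᵇ entry (eulerianRow n) k * (entry (eulerianRow n) k ∸ 1)) →
    EulerianInequality k n
  inequality-by-computation k n check =
    subst₂ (λ b a → 2 * b < a * (a ∸ 1)) (sym (A≡entry n (suc (3 * k)))) (sym (A≡entry n k)) (<ᵇ⇒< _ _ check)

  powerBound-start : ∀ j → PowerBound (3 + j) (4 * (3 + j) + 3)
  powerBound-start 0 = powerBound-by-computation 3 15 _
  powerBound-start 1 = powerBound-by-computation 4 19 _
  powerBound-start 2 = powerBound-by-computation 5 23 _
  powerBound-start 3 = powerBound-by-computation 6 27 _
  powerBound-start 4 = powerBound-by-computation 7 31 _
  powerBound-start 5 = powerBound-by-computation 8 35 _
  powerBound-start 6 = powerBound-by-computation 9 39 _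
  powerBound-start 7 = powerBound-by-computation 10 43 _
  powerBound-start 8 = powerBound-by-computation 11 47 _
  powerBound-start j@(suc (suc (suc (suc (suc (suc (suc (suc (suc i))))))))) =
    powerBound-large (3 + j) (m≤m+n 12 i)

  k+2≤4k+3+t : ∀ k t → suc (suc k) ≤ 4 * k + 3 + t
  k+2≤4k+3+t k t = ≤-trans (subst (suc (suc k) ≤_) (expand k) (m≤m+n (suc (suc k)) (1 + 3 * k))) (m≤m+n _ t)
    where
    expand : ∀ k → suc (suc k) + (1 + 3 * k) ≡ 4 * k + 3
    expand = solve-∀

  -- For k = 2 the power bound holds only from n = 14 on, so n = 11, 12, 13 are evaluated directly.
  inequality-far : ∀ k t → 2 ≤ k → EulerianInequality k (4 * k + 3 + t)
  inequality-far 0 t ()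
  inequality-far 1 t (s≤s ())
  inequality-far 2 0 _ = inequality-by-computation 2 11 _
  inequality-far 2 1 _ = inequality-by-computation 2 12 _
  inequality-far 2 2 _ = inequality-by-computation 2 13 _
  inequality-far 2 (suc (suc (suc t))) _ = inequality-from-power {n = 14 + t} (s≤s z≤n) (k+2≤4k+3+t 2 (3 + t))
    (powerBound-+ ≤-refl (powerBound-by-computation 2 14 _) t)
  inequality-far (suc (suc (suc j))) t _ = inequality-from-power (s≤s z≤n) (k+2≤4k+3+t (3 + j) t)
    (powerBound-+ (s≤s (s≤s z≤n)) (powerBound-start j) t)

  inequality : ∀ k n → 2 ≤ k → 3 + k ≤ n → EulerianInequality k n
  inequality k n 2≤k k+3≤n with n ≤? suc (3 * k)
  ... | yes n≤3k+1 = inequality-from-bound 0<k k+2≤n (begin-strict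
    4 * A n (suc (3 * k))  ≡⟨ cong (4 *_) (A-vanishes n (3 * k) n≤3k+1) ⟩
    0                      <⟨ s≤s z≤n ⟩
    4                      ≤⟨ *-mono-≤ (2≤A 0<k k+2≤n) (2≤A 0<k k+2≤n) ⟩
    A n k * A n k          ∎)
    where
    open ≤-Reasoning
    0<k : 0 < k
    0<k = ≤-trans (s≤s z≤n) 2≤k
    k+2≤n : suc (suc k) ≤ n
    k+2≤n = ≤-trans (n≤1+n _) k+3≤n
  ... | no n≰3k+1 with m≤n⇒∃[o]m+o≡n (≰⇒> n≰3k+1)
  ...   | t , refl with t ≤? k
  ...     | yes t≤k = inequality-near k t 2≤k t≤k
  ...     | no  t≰k with m≤n⇒∃[o]m+o≡n (≰⇒> t≰k)
  ...       | s , refl = subst (EulerianInequality k) (regroup k s) (inequality-far k s 2≤k)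
    where
    regroup : ∀ k s → 4 * k + 3 + s ≡ 2 + 3 * k + (suc k + s)
    regroup = solve-∀

-- Opened only now: Data.Integer's prefix +_ would make the sections (x +_) above ambiguous.
open import Data.Integer using (+_; _-_; _>_; +<+) renaming (_*_ to _*ℤ_; _<_ to _<ℤ_)
open import Data.Nat using () renaming (_*_ to _*ℕ_)

+[m*[m∸1]]≡+m*[+m-1] : ∀ {m} → 1 ≤ m → + (m * (m ∸ 1)) ≡ + m *ℤ (+ m - + 1)
+[m*[m∸1]]≡+m*[+m-1] {suc m} _ = ℤ.pos-* (suc m) m

open FromRecurrence eulerian eulerian-zero eulerian-suc-zero eulerian-suc-suc using (2≤A; inequality)

mainTheorem18 : (n r : ℕ) → 3 ≤ r → r ≤ n ∸ 2 →
    (+ eulerian n (r ∸ 1)) *ℤ (+ eulerian n (r ∸ 1) - + 1) > + 2 *ℤ + eulerian n (3 *ℕ r ∸ 2)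
mainTheorem18 zero            (suc k) _         ()
mainTheorem18 (suc zero)      (suc k) _         ()
mainTheorem18 n@(suc (suc _)) (suc k) (s≤s 2≤k) k+1≤n∸2 =
  subst₂ _<ℤ_ (ℤ.pos-* 2 b) (+[m*[m∸1]]≡+m*[+m-1] 1≤a) (+<+ inequalityℕ)
  where
  a = eulerian n k
  b = eulerian n (3 * suc k ∸ 2)
  k+3≤n : 3 + k ≤ n
  k+3≤n = s≤s (s≤s k+1≤n∸2)
  1≤a : 1 ≤ a
  1≤a = ≤-trans (s≤s z≤n) (2≤A (≤-trans (s≤s z≤n) 2≤k) (≤-trans (n≤1+n _) k+3≤n))
  inequalityℕ : 2 * b < a * (a ∸ 1)
  inequalityℕ = subst (λ c → 2 * eulerian n c < a * (a ∸ 1)) (cong (_∸ 2) (sym (*-suc 3 k))) (inequality k n 2≤k k+3≤n)
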